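{- Let $F$ be a graph containing a cycle. Then every forest $\mathscr{F}$ of copies of $F$ satisfies $\bigcup\mathscr{F}\not\xrightarrow{\text{n.n.i.}}(F)_2$, i.e., there is a $2$-colouring of the edges of $\bigcup\mathscr{F}$ with no monochromatic subgraph isomorphic to $F$.
   Context: A forest of copies of $F$ is a set $\mathscr{F}$ of graphs isomorphic to $F$ with an enumeration $\{F_1,\dots,F_{|\mathscr{F}|}\}$ such that for each $j\ge 2$ the set $V(F_j)\cap\bigcup_{i<j}V(F_i)$ is empty, a single vertex, or an edge belonging to both $E(F_j)$ and $\bigcup_{i<j}E(F_i)$; $\bigcup\mathscr{F}$ has vertex set $\bigcup V(F_i)$ and edge set $\bigcup E(F_i)$. -}

module Defs where

open import Data.Nat using (ℕ; suc)
open import Data.Fin using (Fin; _<_; inject₁; fromℕ) renaming (suc to fsuc; zero to fzero)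
open import Data.Bool using (Bool)
open import Data.Product using (Σ; ∃; ∃-syntax; _×_; _,_)
open import Data.Sum using (_⊎_)
open import Data.Empty using (⊥)
open import Relation.Nullary using (¬_; Dec)
open import Relation.Binary.PropositionalEquality using (_≡_)
open import Function.Definitions using (Injective)

record Graph : Set₁ where
  field
    n      : ℕ
    Adj    : Fin n → Fin n → Set
    dec    : ∀ a b → Dec (Adj a b)
    sym    : ∀ {a b} → Adj a b → Adj b a
    irrefl : ∀ {a} → ¬ Adj a a
open Graph public

HasCycle : Graph → Set
HasCycle F = ∃[ m ] Σ (Fin (suc (suc (suc m))) → Fin (n F)) λ c →
    Injective _≡_ _≡_ c
  × (∀ (i : Fin (suc (suc m))) → Adj F (c (inject₁ i)) (c (fsuc i)))
  × Adj F (c (fromℕ (suc (suc m)))) (c fzero)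

Copy : Graph → Set
Copy F = Σ (Fin (n F) → ℕ) λ φ → Injective _≡_ _≡_ φ

module _ (F : Graph) where

  VertexOf : Copy F → ℕ → Set
  VertexOf (φ , _) x = ∃[ a ] φ a ≡ x

  EdgeOf : Copy F → ℕ → ℕ → Set
  EdgeOf (φ , _) u v = ∃[ a ] ∃[ b ] Adj F a b × φ a ≡ u × φ b ≡ v

  module _ {m : ℕ} (fs : Fin m → Copy F) where

    EarlierVertex : Fin m → ℕ → Set
    EarlierVertex j x = ∃[ i ] i < j × VertexOf (fs i) x

    EarlierEdge : Fin m → ℕ → ℕ → Set
    EarlierEdge j u v = ∃[ i ] i < j × EdgeOf (fs i) u v

    InS : Fin m → ℕ → Set
    InS j x = VertexOf (fs j) x × EarlierVertex j x

    IsForest : Set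
    IsForest = ∀ j →
        (∀ x → ¬ InS j x)
      ⊎ (∃[ x ] InS j x × (∀ y → InS j y → y ≡ x))
      ⊎ (∃[ u ] ∃[ v ] InS j u × InS j v × (∀ y → InS j y → y ≡ u ⊎ y ≡ v)
           × EdgeOf (fs j) u v × EarlierEdge j u v)

    UnionEdge : ℕ → ℕ → Set
    UnionEdge u v = ∃[ i ] EdgeOf (fs i) u v

    NoMonoCopy : (ℕ → ℕ → Bool) → Set
    NoMonoCopy c = ∀ (ψ : Fin (n F) → ℕ) → Injective _≡_ _≡_ ψ → ∀ (col : Bool) →
      ¬ (∀ a b → Adj F a b → UnionEdge (ψ a) (ψ b) × c (ψ a) (ψ b) ≡ col)

{-# OPTIONS --safe #-}
-- Every edge of ⋃𝓕 is coloured inside the first copy F_j containing it, by a colouring of F that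
-- depends only on how F_j meets the earlier copies: in nothing, a vertex, or an edge uv.
-- Suppose ψ is a monochromatic copy of F. Let B be a 2-connected subgraph of F with the most edges
-- (F has a cycle, so one exists) and F_j the copy in which a vertex of ψ(B) appears last. Then ψ(B)
-- lies in F_j: a walk in B from that vertex to one outside F_j would enter the vertices F_j shares with
-- earlier copies, by 2-connectivity avoiding any chosen one of them, and when they form an edge uv the
-- entering edges at u are red and those at v blue. So ψ(B) is the image of another maximum 2-connected
-- subgraph K of F, all of whose edges except uv are coloured in F_j. The colouring of F orders edges by
-- a key (edges at u heaviest, edges at v lightest) and colours an edge red iff its ends are not joined
-- by a path of heavier edges of F. If K does not contain both u and v, its lightest edge is blue, since
-- K bypasses it, and its heaviest edge is red, since a bypass of heavier edges would be an ear enlarging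
-- K; otherwise an edge of K at u and one at v differ.
module Submission where

open import Data.Nat as ℕ using (ℕ; zero; suc; _+_; _≤_; _<_; z≤n; s≤s; _≤?_)
open import Data.Nat.Properties as ℕ using (≤-trans; ≤-refl; ≰⇒>)
open import Data.Fin as Fin using (Fin; toℕ; combine; _≟_)
open import Data.Fin.Properties as Fin using (any?; combine-injectiveˡ; combine-injectiveʳ; combine-monoˡ-<)
open import Data.Bool using (Bool; true; false; not; T; _∨_)
open import Data.Bool.Properties using (T-∨; ∨-comm; ∨-zeroʳ)
open import Data.Maybe as Maybe using (Maybe; just; nothing)
open import Data.Product
open import Data.Product.Properties using (≡-dec)
open import Data.Sum
open import Data.Empty
open import Data.Unit using (⊤; tt)
open import Data.List as List using (List; []; _∷_; length; filter; cartesianProduct; allFin)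
open import Data.List.Properties using (length-tabulate; length-filter; length-map)
open import Data.List.Membership.Propositional using (_∈_; _∉_)
open import Data.List.Membership.Propositional.Properties using (∈-allFin; ∈-filter⁺; ∈-filter⁻; ∈-cartesianProduct⁺; ∈-map⁻)
open import Data.List.Relation.Binary.Subset.Propositional using (_⊆_)
open import Data.List.Relation.Unary.Any as Any using (here; there)
open import Data.List.Relation.Unary.All as All using (All; []; _∷_)
open import Data.List.Relation.Unary.All.Properties.Core using (¬Any⇒All¬)
open import Data.List.Relation.Unary.AllPairs using ([]; _∷_)
open import Data.List.Relation.Unary.Unique.Propositional using (Unique)
open import Data.List.Relation.Unary.Unique.Propositional.Properties using (filter⁺; cartesianProduct⁺; allFin⁺)
open import Function using (_∘′_; Equivalence; mk⇔)
open import Function.Definitions using (Injective)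
open import Relation.Nullary
open import Relation.Nullary.Decidable using (_⊎-dec_; _×-dec_; map′; toWitness; fromWitness; T?; isYes; dec-true; dec-false; does-⇔)
open import Relation.Binary.Definitions using (DecidableEquality; tri<; tri≈; tri>)
open import Relation.Binary.PropositionalEquality hiding ([_])
open import Relation.Binary.Construct.Closure.ReflexiveTransitive as Star using (Star; ε; _◅_; _◅◅_)
open import Defs using (Graph; HasCycle; Copy; IsForest; NoMonoCopy; VertexOf; EdgeOf; EarlierVertex; EarlierEdge; InS; UnionEdge)

module _ {A : Set} where

  private
    _without_ : ∀ {x} (xs : List A) → x ∈ xs → List A
    (_ ∷ xs) without here _ = xs
    (y ∷ xs) without there p = y ∷ xs without p

    length-without : ∀ {x} (xs : List A) (p : x ∈ xs) → suc (length (xs without p)) ≡ length xs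
    length-without (_ ∷ xs) (here _) = refl
    length-without (y ∷ xs) (there p) = cong suc (length-without xs p)

    ∈-without : ∀ {x z} (xs : List A) (p : x ∈ xs) → z ∈ xs → z ≢ x → z ∈ xs without p
    ∈-without (_ ∷ xs) (here refl) (here refl) z≢x = ⊥-elim (z≢x refl)
    ∈-without (_ ∷ xs) (here refl) (there q) _ = q
    ∈-without (y ∷ xs) (there p) (here refl) _ = here refl
    ∈-without (y ∷ xs) (there p) (there q) z≢x = there (∈-without xs p q z≢x)

  Unique-⊆⇒length≤ : ∀ {xs ys : List A} → Unique xs → xs ⊆ ys → length xs ≤ length ys
  Unique-⊆⇒length≤ {[]} _ _ = z≤n
  Unique-⊆⇒length≤ {x ∷ xs} {ys} (x∉xs ∷ u) xs⊆ys =
    subst (suc (length xs) ≤_) (length-without ys x∈ys) (s≤s (Unique-⊆⇒length≤ u xs⊆ys─x))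
    where
    x∈ys = xs⊆ys (here refl)
    xs⊆ys─x : xs ⊆ ys without x∈ys
    xs⊆ys─x z∈xs = ∈-without ys x∈ys (xs⊆ys (there z∈xs)) (λ z≡x → All.lookup x∉xs z∈xs (sym z≡x))

Unique-map⁺ : ∀ {A B : Set} {P : A → Set} (f : A → B) → (∀ {u v} → P u → P v → f u ≡ f v → u ≡ v) →
  ∀ {ys} → Unique ys → All P ys → Unique (List.map f ys)
Unique-map⁺ f f-inj [] [] = []
Unique-map⁺ {P = P} f f-inj {y ∷ ys} (y∉ys ∷ u) (py ∷ pys) = fy∉ y∉ys pys ∷ Unique-map⁺ f f-inj u pys
  where
  fy∉ : ∀ {zs} → All (y ≢_) zs → All P zs → All (f y ≢_) (List.map f zs)
  fy∉ [] [] = []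
  fy∉ (y≢z ∷ y∉) (pz ∷ pzs) = (y≢z ∘′ f-inj py pz) ∷ fy∉ y∉ pzs

Unique⇒length≤ : ∀ {n} {xs : List (Fin n)} → Unique xs → length xs ≤ n
Unique⇒length≤ {n} {xs} u =
  subst (length xs ≤_) (length-tabulate (λ i → i)) (Unique-⊆⇒length≤ u (λ {i} _ → ∈-allFin i))

module _ {X : Set} (C : X → Set) (μ : X → ℕ) where

  IsMaximum IsMinimum : X → Set
  IsMaximum x = C x × (∀ y → C y → μ y ≤ μ x)
  IsMinimum x = C x × (∀ y → C y → μ x ≤ μ y)

  ¬¬-maximum : ∀ N → (∀ x → C x → μ x ≤ N) → ∃ C → ¬ ¬ ∃ IsMaximum
  ¬¬-maximum N bounded (x₀ , c₀) noMax = go (suc N) x₀ c₀ (ℕ.m≤n+m (suc N) (μ x₀))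
    where
    -- k bounds the number of strict increases of μ still possible below N.
    go : ∀ k x → C x → N < μ x + k → ⊥
    go zero x cx N<μx = ℕ.<⇒≱ (subst (N <_) (ℕ.+-identityʳ (μ x)) N<μx) (bounded x cx)
    go (suc k) x cx N<μx+1+k = noMax (x , cx , dominates)
      where
      dominates : ∀ y → C y → μ y ≤ μ x
      dominates y cy with μ y ≤? μ x
      ... | yes y≤x = y≤x
      ... | no y≰x = ⊥-elim (go k y cy (≤-trans N<μx+1+k μx+1+k≤μy+k))
        where
        μx+1+k≤μy+k : μ x + suc k ≤ μ y + k
        μx+1+k≤μy+k = subst (_≤ μ y + k) (sym (ℕ.+-suc (μ x) k)) (ℕ.+-monoˡ-≤ k (≰⇒> y≰x))

  ¬¬-minimum : ∃ C → ¬ ¬ ∃ IsMinimum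
  ¬¬-minimum (x₀ , c₀) noMin = go (μ x₀) x₀ c₀ ≤-refl
    where
    go : ∀ d x → C x → μ x ≤ d → ⊥
    go zero x cx μx≤0 = noMin (x , cx , λ y _ → ≤-trans μx≤0 z≤n)
    go (suc d) x cx μx≤1+d = noMin (x , cx , dominated)
      where
      dominated : ∀ y → C y → μ x ≤ μ y
      dominated y cy with μ x ≤? μ y
      ... | yes x≤y = x≤y
      ... | no x≰y = ⊥-elim (go d y cy (ℕ.≤-pred (≤-trans (≰⇒> x≰y) μx≤1+d)))

Avoiding : ∀ {A : Set} → (A → A → Set) → A → A → A → Set
Avoiding R w x y = R x y × x ≢ w × y ≢ w

module _ {A : Set} {R : A → A → Set} where

  vertices : ∀ {x y} → Star R x y → List A
  vertices {x} ε = x ∷ []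
  vertices {x} (_ ◅ p) = x ∷ vertices p

  steps : ∀ {x y} → Star R x y → List (A × A)
  steps ε = []
  steps {x} (_◅_ {j = z} _ p) = (x , z) ∷ steps p

  source∈vertices : ∀ {x y} (p : Star R x y) → x ∈ vertices p
  source∈vertices ε = here refl
  source∈vertices (_ ◅ _) = here refl

  target∈vertices : ∀ {x y} (p : Star R x y) → y ∈ vertices p
  target∈vertices ε = here refl
  target∈vertices (_ ◅ p) = there (target∈vertices p)

  ∈-steps⇒rel : ∀ {x y} (p : Star R x y) {u v} → (u , v) ∈ steps p → R u v
  ∈-steps⇒rel (r ◅ _) (here refl) = r
  ∈-steps⇒rel (_ ◅ p) (there m) = ∈-steps⇒rel p m

  ∈-steps⇒∈-vertices : ∀ {x y} (p : Star R x y) {u v} → (u , v) ∈ steps p → u ∈ vertices p × v ∈ vertices p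
  ∈-steps⇒∈-vertices (_ ◅ p) (here refl) = here refl , there (source∈vertices p)
  ∈-steps⇒∈-vertices (_ ◅ p) (there m) = Data.Product.map there there (∈-steps⇒∈-vertices p m)

  first-step : ∀ {x y} (p : Star R x y) → x ≢ y → ∃ λ z → R x z × (x , z) ∈ steps p
  first-step ε x≢x = ⊥-elim (x≢x refl)
  first-step (_◅_ {j = z} r _) _ = z , r , here refl

  crossing : ∀ {X : A → Set} → (∀ a → Dec (X a)) → ∀ {x y} → Star R x y → X x → ¬ X y →
    ∃₂ λ a b → R a b × X a × ¬ X b
  crossing X? ε Xx ¬Xx = ⊥-elim (¬Xx Xx)
  crossing X? {x} (_◅_ {j = z} r p) Xx ¬Xy with X? z
  ... | yes Xz = crossing X? p Xz ¬Xy
  ... | no ¬Xz = x , z , r , Xx , ¬Xz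

  suffix : ∀ {x y z} (p : Star R x y) → z ∈ vertices p → Star R z y
  suffix ε (here refl) = ε
  suffix (r ◅ p) (here refl) = r ◅ p
  suffix (_ ◅ p) (there m) = suffix p m

  vertices-suffix : ∀ {x y z} (p : Star R x y) (m : z ∈ vertices p) → vertices (suffix p m) ⊆ vertices p
  vertices-suffix ε (here refl) v∈ = v∈
  vertices-suffix (_ ◅ p) (here refl) v∈ = v∈
  vertices-suffix (_ ◅ p) (there m) v∈ = there (vertices-suffix p m v∈)

  suffix-Unique : ∀ {x y z} (p : Star R x y) (m : z ∈ vertices p) → Unique (vertices p) → Unique (vertices (suffix p m))
  suffix-Unique ε (here refl) u = u
  suffix-Unique (_ ◅ p) (here refl) u = u
  suffix-Unique (_ ◅ p) (there m) (_ ∷ u) = suffix-Unique p m u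

  avoiding-all : ∀ {w x y} (p : Star R x y) → (∀ {v} → v ∈ vertices p → v ≢ w) → Star (Avoiding R w) x y
  avoiding-all ε _ = ε
  avoiding-all (r ◅ p) avoids = (r , avoids (here refl) , avoids (there (source∈vertices p))) ◅ avoiding-all p (avoids ∘′ there)

  module _ (_≟_ : DecidableEquality A) where

    toPath : ∀ {x y} → Star R x y → Σ (Star R x y) (Unique ∘′ vertices)
    toPath ε = ε , ([] ∷ [])
    toPath {x} (r ◅ p) with toPath p
    ... | q , q-unique with Any.any? (x ≟_) (vertices q)
    ...   | yes x∈q = suffix q x∈q , suffix-Unique q x∈q q-unique
    ...   | no x∉q = r ◅ q , ¬Any⇒All¬ _ x∉q ∷ q-unique

    -- w occurs at most once on a path, so one of the two directions from z avoids it.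
    to-an-end-avoiding : (∀ {x y} → R x y → R y x) →
      ∀ {a b} (p : Star R a b) → Unique (vertices p) → ∀ w {z} → z ∈ vertices p → z ≢ w →
      (a ≢ w × Star (Avoiding R w) z a) ⊎ (b ≢ w × Star (Avoiding R w) z b)
    to-an-end-avoiding _ ε _ w (here refl) z≢w = inj₁ (z≢w , ε)
    to-an-end-avoiding _ (_ ◅ _) _ w (here refl) z≢w = inj₁ (z≢w , ε)
    to-an-end-avoiding R-sym {a} (r ◅ p) (a∉p ∷ u) w (there m) z≢w with to-an-end-avoiding R-sym p u w m z≢w
    ... | inj₂ toB = inj₂ toB
    ... | inj₁ (a′≢w , toA′) with a ≟ w
    ...   | no a≢w = inj₁ (a≢w , toA′ ◅◅ ((R-sym r , a′≢w , a≢w) ◅ ε))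
    ...   | yes refl = inj₂ (≢a (target∈vertices p) , avoiding-all (suffix p m) (λ v∈ → ≢a (vertices-suffix p m v∈)))
      where
      ≢a : ∀ {v} → v ∈ vertices p → v ≢ a
      ≢a v∈p v≡a = All.lookup a∉p v∈p (sym v≡a)

module _ {n} {R : Fin n → Fin n → Set} (R? : ∀ a b → Dec (R a b)) where

  private
    WalkWithin : ℕ → Fin n → Fin n → Set
    WalkWithin zero x y = x ≡ y
    WalkWithin (suc k) x y = x ≡ y ⊎ ∃ λ z → R x z × WalkWithin k z y

    walkWithin? : ∀ k a b → Dec (WalkWithin k a b)
    walkWithin? zero a b = a Fin.≟ b
    walkWithin? (suc k) a b = (a Fin.≟ b) ⊎-dec any? (λ z → R? a z ×-dec walkWithin? k z b)

    WalkWithin⇒Star : ∀ k {x y} → WalkWithin k x y → Star R x y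
    WalkWithin⇒Star zero refl = ε
    WalkWithin⇒Star (suc k) (inj₁ refl) = ε
    WalkWithin⇒Star (suc k) (inj₂ (_ , r , w)) = r ◅ WalkWithin⇒Star k w

    Star⇒WalkWithin : ∀ k {x y} (p : Star R x y) → length (vertices p) ≤ suc k → WalkWithin k x y
    Star⇒WalkWithin zero ε _ = refl
    Star⇒WalkWithin (suc k) ε _ = inj₁ refl
    Star⇒WalkWithin zero (_ ◅ ε) (s≤s ())
    Star⇒WalkWithin zero (_ ◅ _ ◅ _) (s≤s ())
    Star⇒WalkWithin (suc k) (r ◅ p) (s≤s ≤1+k) = inj₂ (_ , r , Star⇒WalkWithin k p ≤1+k)

  -- A shortest walk has at most n vertices, so walks of at most n steps suffice.
  star? : ∀ a b → Dec (Star R a b)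
  star? a b = map′ (WalkWithin⇒Star n) within-n (walkWithin? n a b)
    where
    within-n : Star R a b → WalkWithin n a b
    within-n p with toPath Fin._≟_ p
    ... | q , q-unique = Star⇒WalkWithin n q (ℕ.m≤n⇒m≤1+n (Unique⇒length≤ q-unique))

first : ∀ {k} {P : Fin k → Set} → (∀ i → Dec (P i)) → Maybe (Fin k)
first {zero} P? = nothing
first {suc k} P? with P? Fin.zero
... | yes _ = just Fin.zero
... | no _ = Maybe.map Fin.suc (first (λ i → P? (Fin.suc i)))

data First {k} (P : Fin k → Set) : Maybe (Fin k) → Set where
  just : ∀ j → P j → (∀ i → i Fin.< j → ¬ P i) → First P (just j)
  nothing : (∀ i → ¬ P i) → First P nothing

first-view : ∀ {k} {P : Fin k → Set} (P? : ∀ i → Dec (P i)) → First P (first P?)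
first-view {zero} P? = nothing (λ ())
first-view {suc k} P? with P? Fin.zero
... | yes P0 = just Fin.zero P0 (λ _ ())
... | no ¬P0 with first (λ i → P? (Fin.suc i)) | first-view (λ i → P? (Fin.suc i))
...   | just j | just .j Pj below = just (Fin.suc j) Pj λ where
        Fin.zero _ → ¬P0
        (Fin.suc i) (s≤s i<j) → below i i<j
...   | nothing | nothing ∄ = nothing λ where
        Fin.zero → ¬P0
        (Fin.suc i) → ∄ i

first-≡ : ∀ {k} {P : Fin k → Set} (P? : ∀ i → Dec (P i)) →
  ∀ j → P j → (∀ i → i Fin.< j → ¬ P i) → first P? ≡ just j
first-≡ P? j Pj below with first P? | first-view P?
... | nothing | nothing ∄ = ⊥-elim (∄ j Pj)
... | just j′ | just .j′ Pj′ below′ with Fin.<-cmp j j′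
...   | tri< j<j′ _ _ = ⊥-elim (below′ j j<j′ Pj)
...   | tri≈ _ refl _ = refl
...   | tri> _ _ j′<j = ⊥-elim (below j′ j′<j Pj′)

first-cong : ∀ {k} {P Q : Fin k → Set} (P? : ∀ i → Dec (P i)) (Q? : ∀ i → Dec (Q i)) →
  (∀ i → P i → Q i) → (∀ i → Q i → P i) → first P? ≡ first Q?
first-cong P? Q? P⇒Q Q⇒P with first P? | first-view P?
... | nothing | nothing ∄P = sym (go (first Q?) (first-view Q?))
  where
  go : ∀ r → First _ r → r ≡ nothing
  go _ (nothing _) = refl
  go _ (just j Qj _) = ⊥-elim (∄P j (Q⇒P j Qj))
... | just j | just .j Pj below = sym (first-≡ Q? j (P⇒Q j Pj) (λ i i<j Qi → below i i<j (Q⇒P i Qi)))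

module Subgraphs (F : Graph) where
  open Graph F using (n; Adj; irrefl) renaming (sym to Adj-sym)

  V : Set
  V = Fin n

  Subgraph : Set
  Subgraph = V → V → Bool

  record Edge (K : Subgraph) (a b : V) : Set where
    constructor mkEdge
    field holds : T (K a b)

  edge? : ∀ K a b → Dec (Edge K a b)
  edge? K a b = map′ mkEdge Edge.holds (T? (K a b))

  Vertex : Subgraph → V → Set
  Vertex K x = ∃ (Edge K x)

  vertex? : ∀ K x → Dec (Vertex K x)
  vertex? K x = any? (edge? K x)

  _⊆ᴱ_ : Subgraph → Subgraph → Set
  K ⊆ᴱ K′ = ∀ {a b} → Edge K a b → Edge K′ a b

  record IsSubgraph (K : Subgraph) : Set where
    field
      edge⇒adj : ∀ {a b} → Edge K a b → Adj a b
      edge-sym : ∀ {a b} → Edge K a b → Edge K b a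

    edge-irrefl : ∀ {a b} → Edge K a b → a ≢ b
    edge-irrefl e refl = irrefl (edge⇒adj e)

    source : ∀ {a b} → Edge K a b → Vertex K a
    source e = _ , e

    target : ∀ {a b} → Edge K a b → Vertex K b
    target e = _ , edge-sym e

    avoiding-sym : ∀ {w u v} → Avoiding (Edge K) w u v → Avoiding (Edge K) w v u
    avoiding-sym (e , u≢w , v≢w) = edge-sym e , v≢w , u≢w

  record ThreeVertices (K : Subgraph) : Set where
    constructor three
    field
      {p q r} : V
      p∈K : Vertex K p
      q∈K : Vertex K q
      r∈K : Vertex K r
      p≢q : p ≢ q
      p≢r : p ≢ r
      q≢r : q ≢ r

    vertex-other-than : ∀ x y → ∃ λ w → Vertex K w × w ≢ x × w ≢ y
    vertex-other-than x y with (p ≟ x) ⊎-dec (p ≟ y)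
    ... | no p∉ = p , p∈K , p∉ ∘′ inj₁ , p∉ ∘′ inj₂
    ... | yes p∈ with (q ≟ x) ⊎-dec (q ≟ y)
    ...   | no q∉ = q , q∈K , q∉ ∘′ inj₁ , q∉ ∘′ inj₂
    ...   | yes q∈ = r , r∈K , r∉ p∈ q∈
      where
      r∉ : p ≡ x ⊎ p ≡ y → q ≡ x ⊎ q ≡ y → r ≢ x × r ≢ y
      r∉ (inj₁ p≡x) (inj₁ q≡x) = ⊥-elim (p≢q (trans p≡x (sym q≡x)))
      r∉ (inj₂ p≡y) (inj₂ q≡y) = ⊥-elim (p≢q (trans p≡y (sym q≡y)))
      r∉ (inj₁ p≡x) (inj₂ q≡y) = (λ r≡x → p≢r (trans p≡x (sym r≡x))) , (λ r≡y → q≢r (trans q≡y (sym r≡y)))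
      r∉ (inj₂ p≡y) (inj₁ q≡x) = (λ r≡x → q≢r (trans q≡x (sym r≡x))) , (λ r≡y → p≢r (trans p≡y (sym r≡y)))

    two-vertices-other-than : ∀ x → ∃₂ λ y z → Vertex K y × Vertex K z × y ≢ z × y ≢ x × z ≢ x
    two-vertices-other-than x with p ≟ x | q ≟ x
    ... | yes p≡x | _ =
      q , r , q∈K , r∈K , q≢r , (λ q≡x → p≢q (trans p≡x (sym q≡x))) , (λ r≡x → p≢r (trans p≡x (sym r≡x)))
    ... | no p≢x | yes q≡x = p , r , p∈K , r∈K , p≢r , p≢x , (λ r≡x → q≢r (trans q≡x (sym r≡x)))
    ... | no p≢x | no q≢x = p , q , p∈K , q∈K , p≢q , p≢x , q≢x

  record TwoConnected (K : Subgraph) : Set where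
    field
      threeVertices : ThreeVertices K
      avoiding : ∀ w {x y} → Vertex K x → Vertex K y → x ≢ w → y ≢ w → Star (Avoiding (Edge K) w) x y

    open ThreeVertices threeVertices public

    connected : ∀ {x y} → Vertex K x → Vertex K y → Star (Edge K) x y
    connected {x} {y} x∈K y∈K with vertex-other-than x y
    ... | w , _ , w≢x , w≢y = Star.map proj₁ (avoiding w x∈K y∈K (w≢x ∘′ sym) (w≢y ∘′ sym))

    edge-avoiding : ∀ w → ∃₂ λ x z → Edge K x z × x ≢ w × z ≢ w
    edge-avoiding w with two-vertices-other-than w
    ... | x , y , x∈K , y∈K , x≢y , x≢w , y≢w with first-step (avoiding w x∈K y∈K x≢w y≢w) x≢y
    ...   | z , (e , _ , z≢w) , _ = x , z , e , x≢w , z≢w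

  TwoConnectedSubgraph : Subgraph → Set
  TwoConnectedSubgraph K = IsSubgraph K × TwoConnected K

  pairs : List (V × V)
  pairs = cartesianProduct (allFin n) (allFin n)

  private
    edges : Subgraph → List (V × V)
    edges K = filter (uncurry (edge? K)) pairs

    ∈-edges : ∀ {K a b} → Edge K a b → (a , b) ∈ edges K
    ∈-edges {K} {a} {b} e = ∈-filter⁺ (uncurry (edge? K)) (∈-cartesianProduct⁺ (∈-allFin a) (∈-allFin b)) e

    ∈-edges⁻ : ∀ {K a b} → (a , b) ∈ edges K → Edge K a b
    ∈-edges⁻ {K} ab∈K = proj₂ (∈-filter⁻ (uncurry (edge? K)) {xs = pairs} ab∈K)

    edges-Unique : ∀ K → Unique (edges K)
    edges-Unique K = filter⁺ (uncurry (edge? K)) (cartesianProduct⁺ (allFin⁺ n) (allFin⁺ n))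

  size : Subgraph → ℕ
  size K = length (edges K)

  size≤ : ∀ K → size K ≤ length pairs
  size≤ K = length-filter (uncurry (edge? K)) pairs

  Unique⇒length≤size : ∀ K {xs} → Unique xs → (∀ {a b} → (a , b) ∈ xs → Edge K a b) → length xs ≤ size K
  Unique⇒length≤size K {xs} xs-unique xs⊆K =
    Unique-⊆⇒length≤ {xs = xs} {ys = edges K} xs-unique (λ {(a , b)} ab∈xs → ∈-edges (xs⊆K ab∈xs))

  size-< : ∀ {K K′ a b} → K ⊆ᴱ K′ → Edge K′ a b → ¬ Edge K a b → size K < size K′
  size-< {K} {K′} {a} {b} K⊆K′ e′ ¬e =
    Unique⇒length≤size K′ ((¬Any⇒All¬ _ ab∉K) ∷ edges-Unique K) ⊆K′
    where
    ab∉K : (a , b) ∉ edges K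
    ab∉K = ¬e ∘′ ∈-edges⁻
    ⊆K′ : ∀ {x y} → (x , y) ∈ (a , b) ∷ edges K → Edge K′ x y
    ⊆K′ (here refl) = e′
    ⊆K′ (there xy∈K) = K⊆K′ (∈-edges⁻ xy∈K)

  SymIn : List (V × V) → V → V → Set
  SymIn L x y = (x , y) ∈ L ⊎ (y , x) ∈ L

  private
    open import Data.List.Membership.DecPropositional (≡-dec (_≟_ {n}) (_≟_ {n})) using (_∈?_)

    symIn? : ∀ L x y → Dec (SymIn L x y)
    symIn? L x y = ((x , y) ∈? L) ⊎-dec ((y , x) ∈? L)

  _∪_ : Subgraph → List (V × V) → Subgraph
  (K ∪ L) x y = K x y ∨ isYes (symIn? L x y)

  ∪-inj₁ : ∀ {K} L → K ⊆ᴱ (K ∪ L)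
  ∪-inj₁ L (mkEdge e) = mkEdge (Equivalence.from T-∨ (inj₁ e))

  ∪-inj₂ : ∀ {K} L {x y} → SymIn L x y → Edge (K ∪ L) x y
  ∪-inj₂ {K} L {x} {y} i = mkEdge (Equivalence.from (T-∨ {K x y}) (inj₂ (fromWitness {a? = symIn? L x y} i)))

  ∪-elim : ∀ {K} L {x y} → Edge (K ∪ L) x y → Edge K x y ⊎ SymIn L x y
  ∪-elim {K} L {x} {y} (mkEdge e) = Data.Sum.map mkEdge (toWitness {a? = symIn? L x y}) (Equivalence.to T-∨ e)

  private
    along : ∀ {R : V → V → Set} L {x y} (p : Star R x y) → steps p ⊆ L →
      Σ (Star (SymIn L) x y) λ q → vertices q ≡ vertices p
    along L ε _ = ε , refl
    along L {x} (r ◅ p) p⊆L with along L p (p⊆L ∘′ there)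
    ... | q , q≡p = inj₁ (p⊆L (here refl)) ◅ q , cong (x ∷_) q≡p

  add-ear : ∀ {K} → IsSubgraph K → TwoConnected K → ∀ {R : V → V → Set} → (∀ {x y} → R x y → Adj x y) →
    ∀ {a b} → Vertex K a → Vertex K b → (P : Star R a b) → Unique (vertices P) →
    TwoConnectedSubgraph (K ∪ steps P)
  add-ear {K} K-sub K-2conn R⇒adj {a} {b} a∈K b∈K P P-unique = K′-sub , K′-2conn
    where
    open IsSubgraph K-sub
    open TwoConnected K-2conn
    L = steps P
    K′ = K ∪ L

    K′-sub : IsSubgraph K′
    K′-sub = record { edge⇒adj = adj ; edge-sym = sy }
      where
      adj : ∀ {x y} → Edge K′ x y → Adj x y
      adj e with ∪-elim L e
      ... | inj₁ k = edge⇒adj k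
      ... | inj₂ (inj₁ m) = R⇒adj (∈-steps⇒rel P m)
      ... | inj₂ (inj₂ m) = Adj-sym (R⇒adj (∈-steps⇒rel P m))
      sy : ∀ {x y} → Edge K′ x y → Edge K′ y x
      sy e with ∪-elim L e
      ... | inj₁ k = ∪-inj₁ L (edge-sym k)
      ... | inj₂ i = ∪-inj₂ L (Data.Sum.swap i)

    K⊆K′ : ∀ {x} → Vertex K x → Vertex K′ x
    K⊆K′ (y , e) = y , ∪-inj₁ L e

    P′ = proj₁ (along L P (λ m → m))
    P′-unique : Unique (vertices P′)
    P′-unique = subst Unique (sym (proj₂ (along L P (λ m → m)))) P-unique

    x∈P′ : ∀ {x y} → SymIn L x y → x ∈ vertices P′
    x∈P′ i = subst (_ ∈_) (sym (proj₂ (along L P (λ m → m)))) (x∈P i)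
      where
      x∈P : ∀ {x y} → SymIn L x y → x ∈ vertices P
      x∈P (inj₁ m) = proj₁ (∈-steps⇒∈-vertices P m)
      x∈P (inj₂ m) = proj₂ (∈-steps⇒∈-vertices P m)

    lift : ∀ {w u v} → Avoiding (SymIn L) w u v → Avoiding (Edge K′) w u v
    lift (i , u≢w , v≢w) = ∪-inj₂ L i , u≢w , v≢w

    to-K : ∀ w {x} → Vertex K′ x → x ≢ w → ∃ λ k → Vertex K k × k ≢ w × Star (Avoiding (Edge K′) w) x k
    to-K w {x} (y , e) x≢w with vertex? K x | ∪-elim L e
    ... | yes x∈K | _ = x , x∈K , x≢w , ε
    ... | no x∉K | inj₁ k = ⊥-elim (x∉K (y , k))
    ... | no _ | inj₂ i with to-an-end-avoiding _≟_ Data.Sum.swap P′ P′-unique w (x∈P′ i) x≢w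
    ...   | inj₁ (a≢w , toA) = a , a∈K , a≢w , Star.map lift toA
    ...   | inj₂ (b≢w , toB) = b , b∈K , b≢w , Star.map lift toB

    K′-2conn : TwoConnected K′
    K′-2conn = record
      { threeVertices = three (K⊆K′ p∈K) (K⊆K′ q∈K) (K⊆K′ r∈K) p≢q p≢r q≢r
      ; avoiding = avoid
      }
      where
      avoid : ∀ w {x y} → Vertex K′ x → Vertex K′ y → x ≢ w → y ≢ w → Star (Avoiding (Edge K′) w) x y
      avoid w x∈K′ y∈K′ x≢w y≢w with to-K w x∈K′ x≢w | to-K w y∈K′ y≢w
      ... | k , k∈K , k≢w , x→k | l , l∈K , l≢w , y→l =
        x→k ◅◅ Star.map (λ (e , u≢w , v≢w) → ∪-inj₁ L e , u≢w , v≢w) (avoiding w k∈K l∈K k≢w l≢w)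
            ◅◅ Star.reverse (IsSubgraph.avoiding-sym K′-sub) y→l

  avoiding-value : ∀ {K} → IsSubgraph K → TwoConnected K → {A : Set} → DecidableEquality A → (f : V → A) →
    (∀ {x y} → Vertex K x → Vertex K y → f x ≡ f y → x ≡ y) →
    ∀ t {x y} → Vertex K x → Vertex K y → f x ≢ t → f y ≢ t →
    Star (λ u v → Edge K u v × f u ≢ t × f v ≢ t) x y
  avoiding-value {K} K-sub K-2conn _≟ᴬ_ f f-inj t {x} {y} x∈K y∈K fx≢t fy≢t
    with any? (λ w → vertex? K w ×-dec (f w ≟ᴬ t))
  ... | yes (w , w∈K , fw≡t) =
    Star.map avoid (avoiding w x∈K y∈K (λ x≡w → fx≢t (trans (cong f x≡w) fw≡t))
                                       (λ y≡w → fy≢t (trans (cong f y≡w) fw≡t)))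
    where
    open IsSubgraph K-sub
    open TwoConnected K-2conn
    avoid : ∀ {u v} → Avoiding (Edge K) w u v → Edge K u v × f u ≢ t × f v ≢ t
    avoid (e , u≢w , v≢w) = e , (λ fu≡t → u≢w (f-inj (source e) w∈K (trans fu≡t (sym fw≡t))))
                              , (λ fv≡t → v≢w (f-inj (target e) w∈K (trans fv≡t (sym fw≡t))))
  ... | no ∄w = Star.map avoid (TwoConnected.connected K-2conn x∈K y∈K)
    where
    open IsSubgraph K-sub
    avoid : ∀ {u v} → Edge K u v → Edge K u v × f u ≢ t × f v ≢ t
    avoid e = e , (λ fu≡t → ∄w (_ , source e , fu≡t)) , (λ fv≡t → ∄w (_ , target e , fv≡t))

  module Image {B : Subgraph} (B-sub : IsSubgraph B) (B-2conn : TwoConnected B) (σ : V → V)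
               (σ-inj : ∀ {x y} → Vertex B x → Vertex B y → σ x ≡ σ y → x ≡ y)
               (σ-hom : ∀ {a b} → Edge B a b → Adj (σ a) (σ b)) where

    open IsSubgraph B-sub

    ImageEdge : V → V → Set
    ImageEdge x y = ∃₂ λ a b → Edge B a b × σ a ≡ x × σ b ≡ y

    image : Subgraph
    image x y = isYes (any? λ a → any? λ b → edge? B a b ×-dec (σ a ≟ x) ×-dec (σ b ≟ y))

    image-edge : ∀ {a b} → Edge B a b → Edge image (σ a) (σ b)
    image-edge {a} {b} e = mkEdge (fromWitness (a , b , e , refl , refl))

    image-edge⁻ : ∀ {x y} → Edge image x y → ImageEdge x y
    image-edge⁻ (mkEdge e) = toWitness e

    image-vertex : ∀ {a} → Vertex B a → Vertex image (σ a)
    image-vertex (b , e) = σ b , image-edge e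

    image-vertex⁻ : ∀ {x} → Vertex image x → ∃ λ a → Vertex B a × σ a ≡ x
    image-vertex⁻ (_ , e) with image-edge⁻ e
    ... | a , b , eab , σa≡x , _ = a , source eab , σa≡x

    image-sub : IsSubgraph image
    image-sub = record { edge⇒adj = adj ; edge-sym = sy }
      where
      adj : ∀ {x y} → Edge image x y → Adj x y
      adj e with image-edge⁻ e
      ... | a , b , eab , refl , refl = σ-hom eab
      sy : ∀ {x y} → Edge image x y → Edge image y x
      sy e with image-edge⁻ e
      ... | a , b , eab , refl , refl = image-edge (edge-sym eab)

    image-2conn : TwoConnected image
    image-2conn = record
      { threeVertices = three (image-vertex p∈K) (image-vertex q∈K) (image-vertex r∈K)
                              (p≢q ∘′ σ-inj p∈K q∈K) (p≢r ∘′ σ-inj p∈K r∈K) (q≢r ∘′ σ-inj q∈K r∈K)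
      ; avoiding = avoid
      }
      where
      open TwoConnected B-2conn
      avoid : ∀ w {x y} → Vertex image x → Vertex image y → x ≢ w → y ≢ w → Star (Avoiding (Edge image) w) x y
      avoid w x∈ y∈ x≢w y≢w with image-vertex⁻ x∈ | image-vertex⁻ y∈
      ... | a , a∈B , refl | b , b∈B , refl =
        Star.gmap σ (λ (e , u≢w , v≢w) → image-edge e , u≢w , v≢w)
          (avoiding-value B-sub B-2conn _≟_ σ σ-inj w a∈B b∈B x≢w y≢w)

    size-image : size B ≤ size image
    size-image = subst (_≤ size image) (length-map σ² (edges B))
      (Unique⇒length≤size image (Unique-map⁺ σ² σ²-inj (edges-Unique B) (All.tabulate ∈-edges⁻)) image-edges)
      where
      σ² : V × V → V × V
      σ² (a , b) = σ a , σ b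
      σ²-inj : ∀ {u v} → uncurry (Edge B) u → uncurry (Edge B) v → σ² u ≡ σ² v → u ≡ v
      σ²-inj e e′ eq = cong₂ _,_ (σ-inj (source e) (source e′) (cong proj₁ eq))
                                 (σ-inj (target e) (target e′) (cong proj₂ eq))
      image-edges : ∀ {x y} → (x , y) ∈ List.map σ² (edges B) → Edge image x y
      image-edges xy∈ with ∈-map⁻ σ² xy∈
      ... | (a , b) , ab∈B , refl = image-edge (∈-edges⁻ ab∈B)

  -- The cycle is walked along ℕ-indices 0 … L, where index L denotes c 0 again.
  module Cycle {m} (c : Fin (suc (suc (suc m))) → V) (c-inj : ∀ {i j} → c i ≡ c j → i ≡ j)
               (c-adj : ∀ (i : Fin (suc (suc m))) → Adj (c (Fin.inject₁ i)) (c (Fin.suc i)))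
               (c-adj-last : Adj (c (Fin.fromℕ (suc (suc m)))) (c Fin.zero)) where

    L : ℕ
    L = suc (suc (suc m))

    d : ℕ → V
    d k with k ℕ.<? L
    ... | yes k<L = c (Fin.fromℕ< k<L)
    ... | no _ = c Fin.zero

    d-c : ∀ {k} (k<L : k < L) → d k ≡ c (Fin.fromℕ< k<L)
    d-c {k} k<L with k ℕ.<? L
    ... | yes k<L′ = cong c (Fin.fromℕ<-cong k k refl k<L′ k<L)
    ... | no k≮L = ⊥-elim (k≮L k<L)

    d-L : d L ≡ d 0
    d-L with L ℕ.<? L
    ... | yes L<L = ⊥-elim (ℕ.<-irrefl refl L<L)
    ... | no _ = refl

    d-inj : ∀ {k k′} → k < L → k′ < L → d k ≡ d k′ → k ≡ k′
    d-inj k<L k′<L eq = begin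
      _                        ≡⟨ Fin.toℕ-fromℕ< k<L ⟨
      toℕ (Fin.fromℕ< k<L)  ≡⟨ cong toℕ (c-inj (trans (sym (d-c k<L)) (trans eq (d-c k′<L)))) ⟩
      toℕ (Fin.fromℕ< k′<L) ≡⟨ Fin.toℕ-fromℕ< k′<L ⟩
      _                        ∎
      where open ≡-Reasoning

    d-adj : ∀ {k} → k < L → Adj (d k) (d (suc k))
    d-adj {k} k<L with suc k ℕ.<? L
    ... | yes 1+k<L = subst₂ Adj (trans (cong c (Fin.toℕ-injective inject≡)) (sym (d-c k<L)))
                                 (cong c (Fin.toℕ-injective suc≡)) (c-adj i)
      where
      i = Fin.fromℕ< (ℕ.≤-pred 1+k<L)
      inject≡ : toℕ (Fin.inject₁ i) ≡ toℕ (Fin.fromℕ< k<L)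
      inject≡ = trans (Fin.toℕ-inject₁ i) (trans (Fin.toℕ-fromℕ< _) (sym (Fin.toℕ-fromℕ< k<L)))
      suc≡ : toℕ (Fin.suc i) ≡ toℕ (Fin.fromℕ< 1+k<L)
      suc≡ = trans (cong suc (Fin.toℕ-fromℕ< _)) (sym (Fin.toℕ-fromℕ< 1+k<L))
    ... | no 1+k≮L = subst (λ x → Adj x (c Fin.zero)) (trans (cong c (Fin.toℕ-injective last≡)) (sym (d-c k<L))) c-adj-last
      where
      last≡ : toℕ (Fin.fromℕ (suc (suc m))) ≡ toℕ (Fin.fromℕ< k<L)
      last≡ = trans (Fin.toℕ-fromℕ _)
                    (trans (ℕ.≤-antisym (ℕ.≤-pred (ℕ.≮⇒≥ 1+k≮L)) (ℕ.≤-pred k<L)) (sym (Fin.toℕ-fromℕ< k<L)))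

    CycleEdge : V → V → Set
    CycleEdge x y = ∃ λ (k : Fin L) → (d (toℕ k) ≡ x × d (suc (toℕ k)) ≡ y)
                                    ⊎ (d (toℕ k) ≡ y × d (suc (toℕ k)) ≡ x)

    cycleEdge? : ∀ x y → Dec (CycleEdge x y)
    cycleEdge? x y = any? λ k → ((d (toℕ k) ≟ x) ×-dec (d (suc (toℕ k)) ≟ y))
                               ⊎-dec ((d (toℕ k) ≟ y) ×-dec (d (suc (toℕ k)) ≟ x))

    cycle : Subgraph
    cycle x y = isYes (cycleEdge? x y)

    cycle-edge : ∀ {x y} → CycleEdge x y → Edge cycle x y
    cycle-edge {x} {y} e = mkEdge (fromWitness {a? = cycleEdge? x y} e)

    cycle-edge⁻ : ∀ {x y} → Edge cycle x y → CycleEdge x y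
    cycle-edge⁻ {x} {y} (mkEdge e) = toWitness {a? = cycleEdge? x y} e

    step : ∀ {k} → k < L → Edge cycle (d k) (d (suc k))
    step {k} k<L = cycle-edge (Fin.fromℕ< k<L , inj₁ (cong d toℕ≡ , cong (d ∘′ suc) toℕ≡))
      where
      toℕ≡ : toℕ (Fin.fromℕ< k<L) ≡ k
      toℕ≡ = Fin.toℕ-fromℕ< k<L

    cycle-sub : IsSubgraph cycle
    cycle-sub = record { edge⇒adj = adj ; edge-sym = sy }
      where
      adj : ∀ {x y} → Edge cycle x y → Adj x y
      adj e with cycle-edge⁻ e
      ... | k , inj₁ (refl , refl) = d-adj (Fin.toℕ<n k)
      ... | k , inj₂ (refl , refl) = Adj-sym (d-adj (Fin.toℕ<n k))
      sy : ∀ {x y} → Edge cycle x y → Edge cycle y x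
      sy e with cycle-edge⁻ e
      ... | k , i = cycle-edge (k , Data.Sum.swap i)

    vertex-index : ∀ {x} → Vertex cycle x → ∃ λ k → k < L × d k ≡ x
    vertex-index (_ , e) with cycle-edge⁻ e
    ... | k , inj₁ (d≡x , _) = toℕ k , Fin.toℕ<n k , d≡x
    ... | k , inj₂ (_ , d≡x) with ℕ.m≤n⇒m<n∨m≡n (Fin.toℕ<n k)
    ...   | inj₁ 1+k<L = suc (toℕ k) , 1+k<L , d≡x
    ...   | inj₂ 1+k≡L = 0 , ℕ.z<s , trans (sym d-L) (trans (cong d (sym 1+k≡L)) d≡x)

    segment : ∀ w {i j} → i ≤ j → j ≤ L → (∀ t → i ≤ t → t ≤ j → d t ≢ w) →
      Star (Avoiding (Edge cycle) w) (d i) (d j)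
    segment w {i} {zero} z≤n _ _ = ε
    segment w {i} {suc j} i≤1+j 1+j≤L avoids with i ℕ.≟ suc j
    ... | yes refl = ε
    ... | no i≢1+j = segment w i≤j (ℕ.<⇒≤ 1+j≤L) (λ t i≤t t≤j → avoids t i≤t (ℕ.m≤n⇒m≤1+n t≤j))
                     ◅◅ ((step 1+j≤L , avoids j i≤j (ℕ.n≤1+n j) , avoids (suc j) i≤1+j ℕ.≤-refl) ◅ ε)
      where
      i≤j = ℕ.≤-pred (ℕ.≤∧≢⇒< i≤1+j i≢1+j)

    segment-outside : ∀ {w k} → k < L → d k ≡ w → ∀ {i j} → i ≤ j → j ≤ L → k < i ⊎ j < k →
      (j ≡ L → k ≢ 0) → Star (Avoiding (Edge cycle) w) (d i) (d j)
    segment-outside {w} {k} k<L dk≡w {i} {j} i≤j j≤L k∉[i,j] L⇒k≢0 = segment w i≤j j≤L avoids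
      where
      avoids : ∀ t → i ≤ t → t ≤ j → d t ≢ w
      avoids t i≤t t≤j dt≡w with t ℕ.≟ L
      ... | yes refl = L⇒k≢0 (ℕ.≤-antisym j≤L t≤j) (sym (d-inj ℕ.z<s k<L (trans (sym d-L) (trans dt≡w (sym dk≡w)))))
      ... | no t≢L = outside k∉[i,j] (d-inj (ℕ.≤∧≢⇒< (ℕ.≤-trans t≤j j≤L) t≢L) k<L (trans dt≡w (sym dk≡w)))
        where
        outside : k < i ⊎ j < k → t ≢ k
        outside (inj₁ k<i) refl = ℕ.<⇒≱ k<i i≤t
        outside (inj₂ j<k) refl = ℕ.<⇒≱ j<k t≤j

    avoiding-forward : ∀ w {i j} → i ≤ j → j < L → d i ≢ w → d j ≢ w → Star (Avoiding (Edge cycle) w) (d i) (d j)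
    avoiding-forward w {i} {j} i≤j j<L di≢w dj≢w with any? (λ (k : Fin L) → d (toℕ k) ≟ w)
    ... | no ∄k = segment w i≤j (ℕ.<⇒≤ j<L)
                    (λ t _ t≤j dt≡w → let t<L = ℕ.≤-<-trans t≤j j<L in
                                      ∄k (Fin.fromℕ< t<L , trans (cong d (Fin.toℕ-fromℕ< t<L)) dt≡w))
    ... | yes (k′ , dk≡w) with ℕ.<-cmp (toℕ k′) i | ℕ.<-cmp (toℕ k′) j
    ...   | tri≈ _ refl _ | _ = ⊥-elim (di≢w dk≡w)
    ...   | _ | tri≈ _ refl _ = ⊥-elim (dj≢w dk≡w)
    ...   | tri< k<i _ _ | _ = segment-outside (Fin.toℕ<n k′) dk≡w i≤j (ℕ.<⇒≤ j<L) (inj₁ k<i) (⊥-elim ∘′ ℕ.<⇒≢ j<L)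
    ...   | _ | tri> _ _ j<k = segment-outside (Fin.toℕ<n k′) dk≡w i≤j (ℕ.<⇒≤ j<L) (inj₂ j<k) (⊥-elim ∘′ ℕ.<⇒≢ j<L)
    -- w = d k lies strictly between d i and d j: go from i down to 0 = L and from L down to j.
    ...   | tri> _ _ i<k | tri< k<j _ _ =
      Star.reverse (IsSubgraph.avoiding-sym cycle-sub) (segment-outside (Fin.toℕ<n k′) dk≡w z≤n (ℕ.<⇒≤ (ℕ.≤-<-trans i≤j j<L)) (inj₂ i<k)
                                         (⊥-elim ∘′ ℕ.<⇒≢ (ℕ.≤-<-trans i≤j j<L)))
      ◅◅ subst (λ x → Star (Avoiding (Edge cycle) w) x (d j)) d-L
           (Star.reverse (IsSubgraph.avoiding-sym cycle-sub) (segment-outside (Fin.toℕ<n k′) dk≡w (ℕ.<⇒≤ j<L) ℕ.≤-refl (inj₁ k<j)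
                                               (λ _ k≡0 → ℕ.n≮0 (subst (i <_) k≡0 i<k))))

    cycle-2conn : TwoConnected cycle
    cycle-2conn = record { threeVertices = three-vertices ; avoiding = avoid }
      where
      three-vertices : ThreeVertices cycle
      three-vertices = three {p = d 0} {d 1} {d 2} (d 1 , step ℕ.z<s) (d 2 , step (ℕ.s≤s ℕ.z<s))
                             (d 1 , IsSubgraph.edge-sym cycle-sub (step (ℕ.s≤s ℕ.z<s)))
                             (λ eq → ℕ.0≢1+n (d-inj ℕ.z<s (ℕ.s≤s ℕ.z<s) eq))
                             (λ eq → ℕ.0≢1+n (d-inj ℕ.z<s (ℕ.s≤s (ℕ.s≤s ℕ.z<s)) eq))
                             (λ eq → ℕ.1+n≢n (sym (ℕ.suc-injective (d-inj (ℕ.s≤s ℕ.z<s) (ℕ.s≤s (ℕ.s≤s ℕ.z<s)) eq))))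
      avoid : ∀ w {x y} → Vertex cycle x → Vertex cycle y → x ≢ w → y ≢ w → Star (Avoiding (Edge cycle) w) x y
      avoid w x∈ y∈ x≢w y≢w with vertex-index x∈ | vertex-index y∈
      ... | i , i<L , refl | j , j<L , refl with ℕ.≤-total i j
      ...   | inj₁ i≤j = avoiding-forward w i≤j j<L x≢w y≢w
      ...   | inj₂ j≤i = Star.reverse (IsSubgraph.avoiding-sym cycle-sub) (avoiding-forward w j≤i i<L y≢w x≢w)

  cycle⇒TwoConnectedSubgraph : HasCycle F → ∃ TwoConnectedSubgraph
  cycle⇒TwoConnectedSubgraph (_ , c , c-inj , c-adj , c-adj-last) = cycle , cycle-sub , cycle-2conn
    where open Cycle c c-inj c-adj c-adj-last

true≢false : true ≢ false
true≢false ()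

module EdgeColouring (F : Graph) where
  open Graph F using (n; Adj; dec) renaming (sym to Adj-sym)
  open Subgraphs F

  ordered : V → V → V × V
  ordered a b with a Fin.≤? b
  ... | yes _ = a , b
  ... | no _ = b , a

  ordered-sym : ∀ a b → ordered a b ≡ ordered b a
  ordered-sym a b with a Fin.≤? b | b Fin.≤? a
  ... | yes a≤b | yes b≤a = cong₂ _,_ (Fin.≤-antisym a≤b b≤a) (Fin.≤-antisym b≤a a≤b)
  ... | yes _ | no _ = refl
  ... | no _ | yes _ = refl
  ... | no a≰b | no b≰a = ⊥-elim (Data.Sum.[ a≰b , b≰a ]′ (Fin.≤-total a b))

  SameEdge : V → V → V → V → Set
  SameEdge a b c d = (a ≡ c × b ≡ d) ⊎ (a ≡ d × b ≡ c)

  ordered-injective : ∀ {a b c d} → ordered a b ≡ ordered c d → SameEdge a b c d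
  ordered-injective {a} {b} {c} {d} eq with a Fin.≤? b | c Fin.≤? d
  ordered-injective refl | yes _ | yes _ = inj₁ (refl , refl)
  ordered-injective refl | yes _ | no _ = inj₂ (refl , refl)
  ordered-injective refl | no _ | yes _ = inj₂ (refl , refl)
  ordered-injective refl | no _ | no _ = inj₁ (refl , refl)

  -- just (U , W): the copy meets the earlier ones exactly in the image of the edge U W.
  Attachment : Set
  Attachment = Maybe (V × V)

  Proper : Attachment → Set
  Proper nothing = ⊤
  Proper (just (U , W)) = U ≢ W

  OffAttachment : Attachment → V → V → Set
  OffAttachment nothing a b = ⊤
  OffAttachment (just (U , W)) a b = ¬ SameEdge a b U W

  touches : V → V → V → Bool
  touches U a b = does (a ≟ U) ∨ does (b ≟ U)

  touches-sym : ∀ U a b → touches U a b ≡ touches U b a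
  touches-sym U a b = ∨-comm (does (a ≟ U)) _

  touches-true : ∀ {U a b} → a ≡ U ⊎ b ≡ U → touches U a b ≡ true
  touches-true {U} {a} {b} (inj₁ a≡U) rewrite dec-true (a ≟ U) a≡U = refl
  touches-true {U} {a} {b} (inj₂ b≡U) rewrite dec-true (b ≟ U) b≡U = ∨-zeroʳ _

  touches-false : ∀ {U a b} → a ≢ U → b ≢ U → touches U a b ≡ false
  touches-false {U} {a} {b} a≢U b≢U rewrite dec-false (a ≟ U) a≢U | dec-false (b ≟ U) b≢U = refl

  data Zone : Set where
    low mid high : Zone

  zoneOf : Bool → Bool → Zone
  zoneOf true _ = high
  zoneOf false true = low
  zoneOf false false = mid

  zone : Attachment → V → V → Zone
  zone nothing a b = mid
  zone (just (U , W)) a b = zoneOf (touches U a b) (touches W a b)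

  zone-sym : ∀ att a b → zone att a b ≡ zone att b a
  zone-sym nothing a b = refl
  zone-sym (just (U , W)) a b = cong₂ zoneOf (touches-sym U a b) (touches-sym W a b)

  rank : Zone → Fin 3
  rank low = Fin.zero
  rank mid = Fin.suc Fin.zero
  rank high = Fin.suc (Fin.suc Fin.zero)

  pairCode : V → V → Fin (n ℕ.* n)
  pairCode a b = uncurry combine (ordered a b)

  key : Attachment → V → V → Fin (3 ℕ.* (n ℕ.* n))
  key att a b = combine (rank (zone att a b)) (pairCode a b)

  key-sym : ∀ att a b → key att a b ≡ key att b a
  key-sym att a b = cong₂ (λ z o → combine (rank z) (uncurry combine o)) (zone-sym att a b) (ordered-sym a b)

  key-injective : ∀ att {a b c d} → key att a b ≡ key att c d → SameEdge a b c d
  key-injective att {a} {b} {c} {d} eq =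
    ordered-injective (combine-injective (combine-injectiveʳ (rank (zone att a b)) (pairCode a b) (rank (zone att c d)) (pairCode c d) eq))
    where
    combine-injective : ∀ {k l} {i j : Fin k} {i′ j′ : Fin l} → combine i i′ ≡ combine j j′ → (i , i′) ≡ (j , j′)
    combine-injective {i = i} {j} {i′} {j′} eq =
      cong₂ _,_ (combine-injectiveˡ i i′ j j′ eq) (combine-injectiveʳ i i′ j j′ eq)

  key-zone-< : ∀ att {a b c d} → rank (zone att a b) Fin.< rank (zone att c d) → key att a b Fin.< key att c d
  key-zone-< att lt = combine-monoˡ-< _ _ lt

  -- true is red; an edge of the middle zone is red iff it lies in the maximum-key spanning forest of F.
  Heavier : Attachment → V → V → V → V → Set
  Heavier att a b x y = Adj x y × key att a b Fin.< key att x y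

  joinedAbove? : ∀ att a b → Dec (Star (Heavier att a b) a b)
  joinedAbove? att a b = star? (λ x y → dec x y ×-dec (key att a b Fin.<? key att x y)) a b

  forestEdge : Attachment → V → V → Bool
  forestEdge att a b = not (does (joinedAbove? att a b))

  forestEdge-sym : ∀ att a b → forestEdge att a b ≡ forestEdge att b a
  forestEdge-sym att a b = cong not (does-⇔ (mk⇔ (reverse a b) (reverse b a)) (joinedAbove? att a b) (joinedAbove? att b a))
    where
    reverse : ∀ a b → Star (Heavier att a b) a b → Star (Heavier att b a) b a
    reverse a b = Star.reverse λ (adj , lt) → Adj-sym adj , subst₂ Fin._<_ (key-sym att a b) (key-sym att _ _) lt

  colourByZone : Zone → Bool → Bool
  colourByZone high _ = true
  colourByZone low _ = false
  colourByZone mid forest = forest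

  colouring : Attachment → V → V → Bool
  colouring att a b = colourByZone (zone att a b) (forestEdge att a b)

  colouring-sym : ∀ att a b → colouring att a b ≡ colouring att b a
  colouring-sym att a b = cong₂ colourByZone (zone-sym att a b) (forestEdge-sym att a b)

  high⇒attached-at : ∀ att {a b} → zone att a b ≡ high →
    ∃ λ U → ∀ {x z} → x ≢ U → z ≢ U → rank (zone att x z) Fin.< rank high
  high⇒attached-at (just (U , W)) _ = U , below-high
    where
    below-high : ∀ {x z} → x ≢ U → z ≢ U → rank (zone (just (U , W)) x z) Fin.< rank high
    below-high {x} {z} x≢U z≢U rewrite touches-false {U} x≢U z≢U with touches W x z
    ... | true = ℕ.z<s
    ... | false = ℕ.s<s ℕ.z<s

  low⇒attached-at : ∀ att {a b} → zone att a b ≡ low →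
    ∃ λ W → ∀ {x z} → x ≢ W → z ≢ W → rank low Fin.< rank (zone att x z)
  low⇒attached-at (just (U , W)) _ = W , above-low
    where
    above-low : ∀ {x z} → x ≢ W → z ≢ W → rank low Fin.< rank (zone (just (U , W)) x z)
    above-low {x} {z} x≢W z≢W rewrite touches-false {W} x≢W z≢W with touches U x z
    ... | true = ℕ.z<s
    ... | false = ℕ.z<s

  Maximum : Subgraph → Set
  Maximum = IsMaximum TwoConnectedSubgraph size

  module _ {K} (K-sub : IsSubgraph K) (K-2conn : TwoConnected K) (att : Attachment) where
    open IsSubgraph K-sub
    open TwoConnected K-2conn

    Lightest Heaviest : V → V → Set
    Lightest a b = ∀ {c d} → Edge K c d → key att a b Fin.≤ key att c d
    Heaviest a b = ∀ {c d} → Edge K c d → key att c d Fin.≤ key att a b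

    heavier : ∀ {a b x y} → Lightest a b → Edge K x y → ¬ SameEdge a b x y → Heavier att a b x y
    heavier lightest e ab≠xy = edge⇒adj e , Fin.≤∧≢⇒< (lightest e) (ab≠xy ∘′ key-injective att)

    lightest-joinedAbove : ∀ {a b} → Edge K a b → Lightest a b → Star (Heavier att a b) a b
    lightest-joinedAbove {a} {b} e lightest with vertex-other-than a b
    ... | c , c∈K , c≢a , c≢b =
      Star.map avoiding-b (avoiding b (source e) c∈K (edge-irrefl e) c≢b)
      ◅◅ Star.map avoiding-a (avoiding a c∈K (target e) c≢a (edge-irrefl e ∘′ sym))
      where
      avoiding-b : ∀ {x y} → Avoiding (Edge K) b x y → Heavier att a b x y
      avoiding-b (exy , x≢b , y≢b) = heavier lightest exy λ where
        (inj₁ (_ , b≡y)) → y≢b (sym b≡y)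
        (inj₂ (_ , b≡x)) → x≢b (sym b≡x)
      avoiding-a : ∀ {x y} → Avoiding (Edge K) a x y → Heavier att a b x y
      avoiding-a (exy , x≢a , y≢a) = heavier lightest exy λ where
        (inj₁ (a≡x , _)) → x≢a (sym a≡x)
        (inj₂ (a≡y , _)) → y≢a (sym a≡y)

    -- A path of heavier edges would be an ear adding the edge after a, which is not in K.
    heaviest-not-joinedAbove : (∀ K′ → TwoConnectedSubgraph K′ → size K′ ℕ.≤ size K) →
      ∀ {a b} → Edge K a b → Heaviest a b → ¬ Star (Heavier att a b) a b
    heaviest-not-joinedAbove maximal e heaviest joined with toPath _≟_ joined
    ... | P , P-unique with first-step P (edge-irrefl e)
    ...   | z , (_ , ab<az) , az∈P =
      ℕ.<⇒≱ (size-< (∪-inj₁ (steps P)) (∪-inj₂ (steps P) (inj₁ az∈P)) (λ az∈K → ℕ.<⇒≱ ab<az (heaviest az∈K)))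
            (maximal _ (add-ear K-sub K-2conn proj₁ (source e) (target e) P P-unique))

    lightest-blue : ∀ {a b} → Edge K a b → Lightest a b → colouring att a b ≡ false
    lightest-blue {a} {b} e lightest = byZone (zone att a b) refl
      where
      byZone : ∀ zn → zone att a b ≡ zn → colourByZone zn (forestEdge att a b) ≡ false
      byZone low _ = refl
      byZone mid _ = cong not (dec-true (joinedAbove? att a b) (lightest-joinedAbove e lightest))
      byZone high zone≡ with high⇒attached-at att zone≡
      ... | U , avoiding-U-lower with edge-avoiding U
      ...   | x , z , exz , x≢U , z≢U = ⊥-elim (ℕ.<⇒≱ (key-zone-< att xz<ab) (lightest exz))
        where
        xz<ab : rank (zone att x z) Fin.< rank (zone att a b)
        xz<ab = subst (λ zn → rank (zone att x z) Fin.< rank zn) (sym zone≡) (avoiding-U-lower x≢U z≢U)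

    heaviest-red : (∀ K′ → TwoConnectedSubgraph K′ → size K′ ℕ.≤ size K) →
      ∀ {a b} → Edge K a b → Heaviest a b → colouring att a b ≡ true
    heaviest-red maximal {a} {b} e heaviest = byZone (zone att a b) refl
      where
      byZone : ∀ zn → zone att a b ≡ zn → colourByZone zn (forestEdge att a b) ≡ true
      byZone high _ = refl
      byZone mid _ = cong not (dec-false (joinedAbove? att a b) (heaviest-not-joinedAbove maximal e heaviest))
      byZone low zone≡ with low⇒attached-at att zone≡
      ... | W , avoiding-W-higher with edge-avoiding W
      ...   | x , z , exz , x≢W , z≢W = ⊥-elim (ℕ.<⇒≱ (key-zone-< att ab<xz) (heaviest exz))
        where
        ab<xz : rank (zone att a b) Fin.< rank (zone att x z)
        ab<xz = subst (λ zn → rank zn Fin.< rank (zone att x z)) (sym zone≡) (avoiding-W-higher x≢W z≢W)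

  colouring-at-U : ∀ {U W z} → colouring (just (U , W)) U z ≡ true
  colouring-at-U {U} {W} {z} rewrite touches-true {U} {U} {z} (inj₁ refl) = refl

  colouring-at-W : ∀ {U W z} → W ≢ U → z ≢ U → colouring (just (U , W)) W z ≡ false
  colouring-at-W {U} {W} {z} W≢U z≢U rewrite touches-false {U} W≢U z≢U | touches-true {W} {W} {z} (inj₁ refl) = refl

  Monochromatic : Subgraph → Attachment → Bool → Set
  Monochromatic K att col = ∀ {a b} → Edge K a b → OffAttachment att a b → colouring att a b ≡ col

  extremal-edges-differ : ∀ {K} → Maximum K → ∀ att col → (∀ {a b} → Edge K a b → OffAttachment att a b) →
    ¬ Monochromatic K att col
  extremal-edges-differ {K} ((K-sub , K-2conn) , maximal) att col off mono =
    ¬¬-minimum C μ some-edge λ ((a , b) , eab , minimal) →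
    ¬¬-maximum C μ _ (λ (c , d) _ → ℕ.<⇒≤ (Fin.toℕ<n (key att c d))) some-edge λ ((c , d) , ecd , maximal′) →
    true≢false (begin
      true               ≡⟨ heaviest-red K-sub K-2conn att maximal ecd (λ e → maximal′ _ e) ⟨
      colouring att c d  ≡⟨ mono ecd (off ecd) ⟩
      col                ≡⟨ mono eab (off eab) ⟨
      colouring att a b  ≡⟨ lightest-blue K-sub K-2conn att eab (λ e → minimal _ e) ⟩
      false              ∎)
    where
    open ≡-Reasoning
    open TwoConnected K-2conn
    C : V × V → Set
    C = uncurry (Edge K)
    μ : V × V → ℕ
    μ = toℕ ∘′ uncurry (key att)
    some-edge : ∃ C
    some-edge = (p , proj₁ p∈K) , proj₂ p∈K

  attachment-edges-differ : ∀ {K} → IsSubgraph K → TwoConnected K → ∀ {U W} → Vertex K U → Vertex K W → U ≢ W →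
    ∀ col → ¬ Monochromatic K (just (U , W)) col
  attachment-edges-differ {K} K-sub K-2conn {U} {W} U∈K W∈K U≢W col mono with TwoConnected.vertex-other-than K-2conn U W
  ... | c , c∈K , c≢U , c≢W
    with first-step (TwoConnected.avoiding K-2conn W U∈K c∈K U≢W c≢W) (c≢U ∘′ sym)
       | first-step (TwoConnected.avoiding K-2conn U W∈K c∈K (U≢W ∘′ sym) c≢U) (c≢W ∘′ sym)
  ...  | z , (eUz , _ , z≢W) , _ | z′ , (eWz′ , _ , z′≢U) , _ =
    true≢false (begin
      true                          ≡⟨ colouring-at-U ⟨
      colouring (just (U , W)) U z  ≡⟨ mono eUz off-Uz ⟩
      col                           ≡⟨ mono eWz′ off-Wz′ ⟨
      colouring (just (U , W)) W z′ ≡⟨ colouring-at-W (U≢W ∘′ sym) z′≢U ⟩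
      false                         ∎)
    where
    open ≡-Reasoning
    off-Uz : ¬ SameEdge U z U W
    off-Uz (inj₁ (_ , z≡W)) = z≢W z≡W
    off-Uz (inj₂ (U≡W , _)) = U≢W U≡W
    off-Wz′ : ¬ SameEdge W z′ U W
    off-Wz′ (inj₁ (W≡U , _)) = U≢W (sym W≡U)
    off-Wz′ (inj₂ (_ , z′≡U)) = z′≢U z′≡U

  maximum-not-monochromatic : ∀ {K} → Maximum K → ∀ att → Proper att → ∀ col → ¬ Monochromatic K att col
  maximum-not-monochromatic K-max nothing _ col = extremal-edges-differ K-max nothing col (λ _ → tt)
  maximum-not-monochromatic {K} K-max@((K-sub , K-2conn) , _) (just (U , W)) U≢W col
    with vertex? K U | vertex? K W
  ... | yes U∈K | yes W∈K = attachment-edges-differ K-sub K-2conn U∈K W∈K U≢W col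
  ... | no U∉K | _ = extremal-edges-differ K-max (just (U , W)) col off
    where
    off : ∀ {a b} → Edge K a b → ¬ SameEdge a b U W
    off e (inj₁ (refl , _)) = U∉K (IsSubgraph.source K-sub e)
    off e (inj₂ (_ , refl)) = U∉K (IsSubgraph.target K-sub e)
  ... | yes _ | no W∉K = extremal-edges-differ K-max (just (U , W)) col off
    where
    off : ∀ {a b} → Edge K a b → ¬ SameEdge a b U W
    off e (inj₁ (_ , refl)) = W∉K (IsSubgraph.target K-sub e)
    off e (inj₂ (refl , _)) = W∉K (IsSubgraph.source K-sub e)

module ForestColouring (F : Graph) {m} (fs : Fin m → Copy F) (forest : IsForest F fs) where
  open Graph F using (n; Adj; dec; irrefl) renaming (sym to Adj-sym)
  open Subgraphs F
  open EdgeColouring F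

  φ : Fin m → V → ℕ
  φ i = proj₁ (fs i)

  φ-injective : ∀ i → Injective _≡_ _≡_ (φ i)
  φ-injective i = proj₂ (fs i)

  vertexOf? : ∀ i x → Dec (VertexOf F (fs i) x)
  vertexOf? i x = any? (λ a → φ i a ℕ.≟ x)

  edgeOf? : ∀ i x y → Dec (EdgeOf F (fs i) x y)
  edgeOf? i x y = any? λ a → any? λ b → dec a b ×-dec (φ i a ℕ.≟ x) ×-dec (φ i b ℕ.≟ y)

  earlierVertex? : ∀ j x → Dec (EarlierVertex F fs j x)
  earlierVertex? j x = any? (λ i → (i Fin.<? j) ×-dec vertexOf? i x)

  New : Fin m → ℕ → Set
  New j x = VertexOf F (fs j) x × ¬ EarlierVertex F fs j x

  new? : ∀ j x → Dec (New j x)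
  new? j x = vertexOf? j x ×-dec ¬? (earlierVertex? j x)

  new≢shared : ∀ {j x y} → New j x → InS F fs j y → x ≢ y
  new≢shared (_ , ¬earlier) (_ , earlier) refl = ¬earlier earlier

  old⇒shared : ∀ {j x} → VertexOf F (fs j) x → ¬ New j x → InS F fs j x
  old⇒shared {j} {x} x∈j ¬new with earlierVertex? j x
  ... | yes earlier = x∈j , earlier
  ... | no ¬earlier = ⊥-elim (¬new (x∈j , ¬earlier))

  first-appearance : ∀ {i x} → VertexOf F (fs i) x → ∃ λ j → New j x
  first-appearance {i} {x} x∈i with first (λ j → vertexOf? j x) | first-view (λ j → vertexOf? j x)
  ... | just j | just .j x∈j below = j , x∈j , λ (k , k<j , x∈k) → below k k<j x∈k
  ... | nothing | nothing ∄ = ⊥-elim (∄ i x∈i)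

  edgeOf-sym : ∀ {i x y} → EdgeOf F (fs i) x y → EdgeOf F (fs i) y x
  edgeOf-sym (a , b , adj , a↦x , b↦y) = b , a , Adj-sym adj , b↦y , a↦x

  edgeOf-irrefl : ∀ {i x} → ¬ EdgeOf F (fs i) x x
  edgeOf-irrefl {i} (a , b , adj , a↦x , b↦x) with φ-injective i (trans a↦x (sym b↦x))
  ... | refl = irrefl adj

  edgeOf-source : ∀ {i x y} → EdgeOf F (fs i) x y → VertexOf F (fs i) x
  edgeOf-source (a , _ , _ , a↦x , _) = a , a↦x

  edgeOf-target : ∀ {i x y} → EdgeOf F (fs i) x y → VertexOf F (fs i) y
  edgeOf-target (_ , b , _ , _ , b↦y) = b , b↦y

  attachmentOf : ∀ {j} {A B : Set} {P : ℕ → ℕ → Set} →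
    A ⊎ B ⊎ (∃₂ λ u v → InS F fs j u × InS F fs j v × P u v) → Attachment
  attachmentOf (inj₁ _) = nothing
  attachmentOf (inj₂ (inj₁ _)) = nothing
  attachmentOf (inj₂ (inj₂ (_ , _ , ((U , _) , _) , ((W , _) , _) , _))) = just (U , W)

  attachment : Fin m → Attachment
  attachment j = attachmentOf (forest j)

  data AttachmentView (j : Fin m) : Set where
    disjoint : (∀ x → ¬ InS F fs j x) → attachment j ≡ nothing → AttachmentView j
    at-vertex : ∀ {s} → InS F fs j s → (∀ y → InS F fs j y → y ≡ s) → attachment j ≡ nothing → AttachmentView j
    at-edge : ∀ {U W} → InS F fs j (φ j U) → InS F fs j (φ j W) → (∀ y → InS F fs j y → y ≡ φ j U ⊎ y ≡ φ j W) →
      EdgeOf F (fs j) (φ j U) (φ j W) → attachment j ≡ just (U , W) → AttachmentView j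

  attachment-view : ∀ j → AttachmentView j
  attachment-view j with forest j in eq
  ... | inj₁ none = disjoint none (cong attachmentOf eq)
  ... | inj₂ (inj₁ (_ , s∈S , only-s)) = at-vertex s∈S only-s (cong attachmentOf eq)
  ... | inj₂ (inj₂ (_ , _ , U∈S@((_ , refl) , _) , W∈S@((_ , refl) , _) , only-UW , eUW , _)) =
    at-edge U∈S W∈S only-UW eUW (cong attachmentOf eq)

  attachment-proper : ∀ j → Proper (attachment j)
  attachment-proper j with attachment-view j
  ... | disjoint _ eq rewrite eq = _
  ... | at-vertex _ _ eq rewrite eq = _
  ... | at-edge _ _ _ eUW eq rewrite eq = λ where refl → edgeOf-irrefl eUW

  preimage : Fin m → ℕ → Maybe V
  preimage j x with vertexOf? j x
  ... | yes (a , _) = just a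
  ... | no _ = nothing

  preimage-φ : ∀ {j a x} → φ j a ≡ x → preimage j x ≡ just a
  preimage-φ {j} {a} {x} a↦x with vertexOf? j x
  ... | yes (a′ , a′↦x) = cong just (φ-injective j (trans a′↦x (sym a↦x)))
  ... | no x∉j = ⊥-elim (x∉j (a , a↦x))

  firstCopyWithEdge : ℕ → ℕ → Maybe (Fin m)
  firstCopyWithEdge x y = first (λ i → edgeOf? i x y)

  -- The clauses giving false are junk: they are never reached on an edge of ⋃𝓕.
  colourIn : Fin m → Maybe V → Maybe V → Bool
  colourIn j (just a) (just b) = colouring (attachment j) a b
  colourIn j _ _ = false

  colourAt : Maybe (Fin m) → ℕ → ℕ → Bool
  colourAt nothing _ _ = false
  colourAt (just j) x y = colourIn j (preimage j x) (preimage j y)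

  colour : ℕ → ℕ → Bool
  colour x y = colourAt (firstCopyWithEdge x y) x y

  colour-sym : ∀ x y → colour x y ≡ colour y x
  colour-sym x y rewrite first-cong (λ i → edgeOf? i x y) (λ i → edgeOf? i y x) (λ _ → edgeOf-sym) (λ _ → edgeOf-sym)
    with firstCopyWithEdge y x
  ... | nothing = refl
  ... | just j = colourIn-sym (preimage j x) (preimage j y)
    where
    colourIn-sym : ∀ ma mb → colourIn j ma mb ≡ colourIn j mb ma
    colourIn-sym (just a) (just b) = colouring-sym (attachment j) a b
    colourIn-sym (just _) nothing = refl
    colourIn-sym nothing (just _) = refl
    colourIn-sym nothing nothing = refl

  colour-in-first-copy : ∀ {j x y a b} → firstCopyWithEdge x y ≡ just j → φ j a ≡ x → φ j b ≡ y →
    colour x y ≡ colouring (attachment j) a b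
  colour-in-first-copy {j} first≡j a↦x b↦y rewrite first≡j | preimage-φ {j} a↦x | preimage-φ {j} b↦y = refl

  firstCopyWithEdge-new : ∀ {j x y} → New j x ⊎ New j y → EdgeOf F (fs j) x y → firstCopyWithEdge x y ≡ just j
  firstCopyWithEdge-new {j} {x} {y} new exy = first-≡ (λ i → edgeOf? i x y) j exy λ i i<j exy′ → not-earlier new i<j exy′
    where
    not-earlier : ∀ {i} → New j x ⊎ New j y → i Fin.< j → ¬ EdgeOf F (fs i) x y
    not-earlier (inj₁ (_ , ¬earlier)) i<j e = ¬earlier (_ , i<j , edgeOf-source e)
    not-earlier (inj₂ (_ , ¬earlier)) i<j e = ¬earlier (_ , i<j , edgeOf-target e)

  shared-edge-earlier : ∀ {i x y} → EdgeOf F (fs i) x y → InS F fs i x → InS F fs i y → EarlierEdge F fs i x y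
  shared-edge-earlier {i} {x} {y} e x∈S y∈S with forest i
  ... | inj₁ none = ⊥-elim (none x x∈S)
  ... | inj₂ (inj₁ (_ , _ , only-s)) =
    ⊥-elim (edgeOf-irrefl (subst (EdgeOf F (fs i) x) (trans (only-s y y∈S) (sym (only-s x x∈S))) e))
  ... | inj₂ (inj₂ (_ , _ , _ , _ , only-uv , _ , (i′ , i′<i , e′))) with only-uv x x∈S | only-uv y y∈S
  ...   | inj₁ refl | inj₁ refl = ⊥-elim (edgeOf-irrefl e)
  ...   | inj₂ refl | inj₂ refl = ⊥-elim (edgeOf-irrefl e)
  ...   | inj₁ refl | inj₂ refl = i′ , i′<i , e′
  ...   | inj₂ refl | inj₁ refl = i′ , i′<i , edgeOf-sym e′

  edge-at-new-vertex : ∀ {j x y} → UnionEdge F fs x y → New j x → (∃ λ k → k Fin.≤ j × VertexOf F (fs k) y) →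
    EdgeOf F (fs j) x y
  edge-at-new-vertex (i , e) = descend (suc (toℕ i)) i ℕ.≤-refl e
    where
    descend : ∀ fuel i → toℕ i < fuel → ∀ {j x y} → EdgeOf F (fs i) x y → New j x →
      (∃ λ k → k Fin.≤ j × VertexOf F (fs k) y) → EdgeOf F (fs j) x y
    descend (suc fuel) i (s≤s i≤fuel) {j} e new@(x∈j , ¬earlier) y-by-j@(k , k≤j , y∈k) with Fin.<-cmp i j
    ... | tri< i<j _ _ = ⊥-elim (¬earlier (i , i<j , edgeOf-source e))
    ... | tri≈ _ refl _ = e
    ... | tri> _ _ j<i
      with shared-edge-earlier e (edgeOf-source e , j , j<i , x∈j) (edgeOf-target e , k , ℕ.≤-<-trans k≤j j<i , y∈k)
    ...   | i′ , i′<i , e′ = descend fuel i′ (ℕ.<-≤-trans i′<i i≤fuel) e′ new y-by-j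

  module MonochromaticCopy (ψ : V → ℕ) (ψ-inj : Injective _≡_ _≡_ ψ) (col : Bool)
         (mono : ∀ a b → Adj a b → UnionEdge F fs (ψ a) (ψ b) × colour (ψ a) (ψ b) ≡ col) where

    module _ {B} (B-max : Maximum B) where
      private
        B-sub = proj₁ (proj₁ B-max)
        B-2conn = proj₂ (proj₁ B-max)
      open IsSubgraph B-sub

      B-edge-union : ∀ {a b} → Edge B a b → UnionEdge F fs (ψ a) (ψ b)
      B-edge-union e = proj₁ (mono _ _ (edge⇒adj e))

      B-edge-colour : ∀ {a b} → Edge B a b → colour (ψ a) (ψ b) ≡ col
      B-edge-colour e = proj₂ (mono _ _ (edge⇒adj e))

      Appears : V × Fin m → Set
      Appears (a , j) = Vertex B a × New j (ψ a)

      appears : ∀ {a} → Vertex B a → ∃ λ j → New j (ψ a)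
      appears (_ , e) = first-appearance (edgeOf-source (proj₂ (B-edge-union e)))

      module Latest {as js} (latest : IsMaximum Appears (toℕ ∘′ proj₂) (as , js)) where
        private
          as∈B = proj₁ (proj₁ latest)
          as-new = proj₂ (proj₁ latest)

        InJs : ℕ → Set
        InJs = VertexOf F (fs js)

        Shared : ℕ → Set
        Shared = InS F fs js

        appears-by-js : ∀ {a} → Vertex B a → ∃ λ k → k Fin.≤ js × VertexOf F (fs k) (ψ a)
        appears-by-js a∈B with appears a∈B
        ... | k , k-new = k , proj₂ latest (_ , k) (a∈B , k-new) , proj₁ k-new

        edge-into-js : ∀ {p q} → Edge B p q → New js (ψ p) → EdgeOf F (fs js) (ψ p) (ψ q)
        edge-into-js e p-new = edge-at-new-vertex (B-edge-union e) p-new (appears-by-js (target e))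

        colour-at-new : ∀ {p q P Q} → Edge B p q → New js (ψ p) ⊎ New js (ψ q) → φ js P ≡ ψ p → φ js Q ≡ ψ q →
          colouring (attachment js) P Q ≡ col
        colour-at-new e (inj₁ p-new) P↦p Q↦q =
          trans (sym (colour-in-first-copy (firstCopyWithEdge-new (inj₁ p-new) (edge-into-js e p-new)) P↦p Q↦q)) (B-edge-colour e)
        colour-at-new e (inj₂ q-new) P↦p Q↦q =
          trans (sym (colour-in-first-copy (firstCopyWithEdge-new (inj₂ q-new) (edgeOf-sym (edge-into-js (edge-sym e) q-new))) P↦p Q↦q))
                (B-edge-colour e)

        leaving-js : ∀ {R : V → V → Set} → (∀ {u v} → R u v → Edge B u v) → ∀ {a} → Star R as a → ¬ InJs (ψ a) →
          ∃₂ λ p q → R p q × New js (ψ p) × Shared (ψ q)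
        leaving-js R⇒B walk a∉js with crossing (λ a → new? js (ψ a)) walk as-new (a∉js ∘′ proj₁)
        ... | p , q , r , p-new , ¬q-new = p , q , r , p-new , old⇒shared (edgeOf-target (edge-into-js (R⇒B r) p-new)) ¬q-new

        leaving-js-avoiding : ∀ {a t} → Vertex B a → ¬ InJs (ψ a) → Shared t →
          ∃₂ λ p q → Edge B p q × New js (ψ p) × Shared (ψ q) × ψ q ≢ t
        leaving-js-avoiding {a} {t} a∈B a∉js t∈S
          with leaving-js proj₁ (avoiding-value B-sub B-2conn ℕ._≟_ ψ (λ _ _ → ψ-inj) t as∈B a∈B
                                   (new≢shared as-new t∈S) (λ { refl → a∉js (proj₁ t∈S) })) a∉js
        ... | p , q , (e , _ , q≢t) , p-new , q∈S = p , q , e , p-new , q∈S , q≢t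

        entering-colour : ∀ {p q Q} → Edge B p q → New js (ψ p) → φ js Q ≡ ψ q →
          ∃ λ P → (∀ {R} → Shared (φ js R) → P ≢ R) × colouring (attachment js) Q P ≡ col
        entering-colour {Q = Q} e p-new@((P , P↦p) , _) Q↦q =
          P , (λ R∈S P≡R → new≢shared p-new R∈S (trans (sym P↦p) (cong (φ js) P≡R))) ,
          trans (colouring-sym (attachment js) Q P) (colour-at-new e (inj₁ p-new) P↦p Q↦q)

        -- Leaving F_js, a walk of B must enter the vertices F_js shares with earlier copies, avoiding
        -- any chosen one of them; for a shared edge U W it enters at W by a blue edge or at U by a red one.
        inside : ∀ {a} → Vertex B a → InJs (ψ a)
        inside {a} a∈B with vertexOf? js (ψ a)
        ... | yes a∈js = a∈js
        ... | no a∉js = ⊥-elim (outside (attachment-view js))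
          where
          outside : AttachmentView js → ⊥
          outside (disjoint none _) with leaving-js (λ e → e) (TwoConnected.connected B-2conn as∈B a∈B) a∉js
          ... | _ , _ , _ , _ , q∈S = none _ q∈S
          outside (at-vertex s∈S only-s _) with leaving-js-avoiding a∈B a∉js s∈S
          ... | _ , _ , _ , _ , q∈S , q≢s = q≢s (only-s _ q∈S)
          outside (at-edge {U} {W} U∈S W∈S only-UW _ att≡)
            with leaving-js-avoiding a∈B a∉js U∈S | leaving-js-avoiding a∈B a∉js W∈S
          ... | _ , _ , e , p-new , q∈S , q≢U | _ , _ , e′ , p′-new , q′∈S , q′≢W
            with only-UW _ q∈S | only-UW _ q′∈S
          ...   | inj₁ q≡U | _ = q≢U q≡U
          ...   | _ | inj₂ q′≡W = q′≢W q′≡W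
          ...   | inj₂ q≡W | inj₁ q′≡U with entering-colour e p-new (sym q≡W) | entering-colour e′ p′-new (sym q′≡U)
          ...     | P , P∉S , W-P≡col | P′ , _ , U-P′≡col = true≢false (begin
            true                           ≡⟨ colouring-at-U ⟨
            colouring (just (U , W)) U P′  ≡⟨ subst (λ att → colouring att U P′ ≡ col) att≡ U-P′≡col ⟩
            col                            ≡⟨ subst (λ att → colouring att W P ≡ col) att≡ W-P≡col ⟨
            colouring (just (U , W)) W P   ≡⟨ colouring-at-W (U≢W ∘′ sym) (P∉S U∈S) ⟩
            false                          ∎)
            where
            open ≡-Reasoning
            U≢W : U ≢ W
            U≢W = subst Proper att≡ (attachment-proper js)

        σ : V → V
        σ a = Maybe.fromMaybe a (preimage js (ψ a))

        σ-spec : ∀ {a} → Vertex B a → φ js (σ a) ≡ ψ a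
        σ-spec {a} a∈B with inside a∈B
        ... | b , b↦a = trans (cong (φ js ∘′ Maybe.fromMaybe a) (preimage-φ b↦a)) b↦a

        σ-at : ∀ {a U} → Vertex B a → ψ a ≡ φ js U → σ a ≡ U
        σ-at a∈B a↦U = φ-injective js (trans (σ-spec a∈B) a↦U)

        σ-injective : ∀ {x y} → Vertex B x → Vertex B y → σ x ≡ σ y → x ≡ y
        σ-injective x∈B y∈B eq = ψ-inj (trans (sym (σ-spec x∈B)) (trans (cong (φ js) eq) (σ-spec y∈B)))

        shared-ends : ∀ {a b} → Edge B a b → Shared (ψ a) → Shared (ψ b) →
          ∃₂ λ U W → attachment js ≡ just (U , W) × SameEdge (σ a) (σ b) U W × EdgeOf F (fs js) (φ js U) (φ js W)
        shared-ends e a∈S b∈S with attachment-view js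
        ... | disjoint none _ = ⊥-elim (none _ a∈S)
        ... | at-vertex _ only-s _ = ⊥-elim (edge-irrefl e (ψ-inj (trans (only-s _ a∈S) (sym (only-s _ b∈S)))))
        ... | at-edge {U} {W} _ _ only-UW eUW att≡ with only-UW _ a∈S | only-UW _ b∈S
        ...   | inj₁ a↦U | inj₁ b↦U = ⊥-elim (edge-irrefl e (ψ-inj (trans a↦U (sym b↦U))))
        ...   | inj₂ a↦W | inj₂ b↦W = ⊥-elim (edge-irrefl e (ψ-inj (trans a↦W (sym b↦W))))
        ...   | inj₁ a↦U | inj₂ b↦W = U , W , att≡ , inj₁ (σ-at (source e) a↦U , σ-at (target e) b↦W) , eUW
        ...   | inj₂ a↦W | inj₁ b↦U = U , W , att≡ , inj₂ (σ-at (source e) a↦W , σ-at (target e) b↦U) , eUW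

        edge-in-js : ∀ {a b} → Edge B a b → EdgeOf F (fs js) (ψ a) (ψ b)
        edge-in-js {a} {b} e with new? js (ψ a) | new? js (ψ b)
        ... | yes a-new | _ = edge-into-js e a-new
        ... | no _ | yes b-new = edgeOf-sym (edge-into-js (edge-sym e) b-new)
        ... | no ¬a-new | no ¬b-new
          with shared-ends e (old⇒shared (inside (source e)) ¬a-new) (old⇒shared (inside (target e)) ¬b-new)
        ...   | U , W , _ , inj₁ (refl , refl) , eUW = subst₂ (EdgeOf F (fs js)) (σ-spec (source e)) (σ-spec (target e)) eUW
        ...   | U , W , _ , inj₂ (refl , refl) , eUW =
          edgeOf-sym (subst₂ (EdgeOf F (fs js)) (σ-spec (target e)) (σ-spec (source e)) eUW)

        σ-hom : ∀ {a b} → Edge B a b → Adj (σ a) (σ b)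
        σ-hom e with edge-in-js e
        ... | a′ , b′ , adj , a′↦a , b′↦b =
          subst₂ Adj (φ-injective js (trans a′↦a (sym (σ-spec (source e)))))
                     (φ-injective js (trans b′↦b (sym (σ-spec (target e))))) adj

        open Image B-sub B-2conn σ σ-injective σ-hom

        image-maximum : Maximum image
        image-maximum = (image-sub , image-2conn) , λ K′ K′-2conn → ℕ.≤-trans (proj₂ B-max K′ K′-2conn) size-image

        image-monochromatic : Monochromatic image (attachment js) col
        image-monochromatic e off with image-edge⁻ e
        ... | a , b , eab , refl , refl with new? js (ψ a) | new? js (ψ b)
        ...   | yes a-new | _ = colour-at-new eab (inj₁ a-new) (σ-spec (source eab)) (σ-spec (target eab))
        ...   | no _ | yes b-new = colour-at-new eab (inj₂ b-new) (σ-spec (source eab)) (σ-spec (target eab))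
        ...   | no ¬a-new | no ¬b-new
          with shared-ends eab (old⇒shared (inside (source eab)) ¬a-new) (old⇒shared (inside (target eab)) ¬b-new)
        ...     | U , W , att≡ , same , _ = ⊥-elim (subst (λ att → OffAttachment att (σ a) (σ b)) att≡ off same)

        impossible : ⊥
        impossible = maximum-not-monochromatic image-maximum (attachment js) (attachment-proper js) col image-monochromatic

    no-monochromatic-copy : HasCycle F → ⊥
    no-monochromatic-copy hc =
      ¬¬-maximum TwoConnectedSubgraph size _ (λ K _ → size≤ K) (cycle⇒TwoConnectedSubgraph hc) λ (B , B-max) →
      ¬¬-maximum (Appears B-max) (toℕ ∘′ proj₂) m (λ (_ , j) _ → ℕ.<⇒≤ (Fin.toℕ<n j)) (some-appearance B-max)
        λ (_ , latest) →
      Latest.impossible B-max latest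
      where
      some-appearance : ∀ {B} (B-max : Maximum B) → ∃ (Appears B-max)
      some-appearance B-max with TwoConnected.p∈K (proj₂ (proj₁ B-max))
      ... | p∈B = (_ , proj₁ (appears B-max p∈B)) , p∈B , proj₂ (appears B-max p∈B)

corollary5p6 : (F : Graph) → HasCycle F →
    (m : ℕ) (fs : Fin m → Copy F) → IsForest F fs →
    Σ (ℕ → ℕ → Bool) λ c → (∀ u v → c u v ≡ c v u) × NoMonoCopy F fs c
corollary5p6 F hasCycle m fs forest =
  colour , colour-sym , λ ψ ψ-inj col mono → MonochromaticCopy.no-monochromatic-copy ψ ψ-inj col mono hasCycle
  where open ForestColouring F fs forest
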